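{- Suppose $\vdash^n_\Gamma a:t:\rho$ holds for some context $\Gamma$ with domain $\{x_1,\dots,x_k\}$, where $x_i$ has type $\rho_i$. Then for all $\ell\le n$ and all closed lambda trees $t_1:\rho_1,\dots,t_k:\rho_k$: if $\Vdash^\ell \Gamma(x_i):t_i:\rho_i$ for every $i$, then $\Vdash^\ell a : t[t_1/x_1,\dots,t_k/x_k]:\rho$.
   Context: Setting: $\Sigma'$ ranked alphabet, $\Sigma=\Sigma'\cup\{\mathcal R,\beta\}$ with $\mathcal R,\beta$ unary; $\mathfrak A$ a fixed trivial automaton over $\Sigma$ (maximal arity $N$) with finite state set $Q$ and $\delta\colon Q\times\Sigma\to\mathcal P((Q\cup\{\ast\})^N)$, $\delta(q,\mathfrak f)\subseteq Q^{\mathrm{ar}(\mathfrak f)}\times\{\ast\}^{N-\mathrm{ar}(\mathfrak f)}$. A run up to level $n$ starting in $q$ on a $\Sigma$-term is a map $r$ from the nodes at distance $\le n$ from the root to $Q$, root $\mapsto q$, such that whenever an $\mathfrak f$-node $p$ and its children $p_1,\dots,p_{\mathrm{ar}(\mathfrak f)}$ are in the domain, $(r(p_1),\dots,r(p_{\mathrm{ar}(\mathfrak f)}),\ast,\dots,\ast)\in\delta(r(p),\mathfrak f)$. Lambda trees: possibly infinite simply-typed trees built from variables, $\lambda x^\rho$, application and constants $\mathfrak f\in\Sigma'$ of type $\iota^{\mathrm{ar}(\mathfrak f)}\to\iota$. Continuous normal form: for closed $t,\vec t$ with $t\vec t:\iota$, coinductively $\mathrm{cn}(rs;\vec t)=\mathcal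 R(\mathrm{cn}(r;s,\vec t))$, $\mathrm{cn}(\lambda x.r;s,\vec t)=\beta(\mathrm{cn}(r[s/x];\vec t))$, $\mathrm{cn}(\mathfrak f;\vec t)=\mathfrak f(t_1^\beta,\dots,t_n^\beta)$, $t^\beta=\mathrm{cn}(t;())$. Semantics: $\llbracket\iota\rrbracket=\mathcal P(Q)$, $\llbracket\rho\to\sigma\rrbracket$ = all functions; $\sqsubseteq$ inclusion on $\mathcal P(Q)$, pointwise on functions. Liftings for $f\in\llbracket\vec\rho\to\iota\rrbracket$: $\mathcal R(f)(\vec a)=\{q\mid\delta(q,\mathcal R)\cap(f\vec a\times\{\ast\}^{N-1})\neq\emptyset\}$, $\beta(f)$ likewise with $\delta(q,\beta)$. A context $\Gamma$ is a finite map from variables $x^\sigma$ to $\llbracket\sigma\rrbracket$; $\Gamma^a_x$ is the update. Proof system $\vdash^n_\Gamma a:t:\rho$ by induction on $n$: (i) $n=0$ always; (ii) $\vdash^n_\Gamma a:x:\rho$ if $a\sqsubseteq\Gamma(x)$; (iii) $\vdash^{n+1}_\Gamma a:st:\sigma$ if there are $f,u$ with $a\sqsubseteq\mathcal R(fu)$, $\vdash^n_\Gamma f:s:\rho\to\sigma$, $\vdash^n_\Gamma u:t:\rho$; (iv) $\vdash^{n+1}_\Gamma f:\lambda x^\rho.s:\rho\to\sigma$ if for each $a\in\llbracket\rho\rrbracket$ some $b_a$ has $fa\sqsubseteq\beta(b_a)$ and $\vdash^n_{\Gamma^a_x}b_a:s:\sigma$; (v) $\vdash^n_\Gamma f:\mathfrak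 f:\iota^{\mathrm{ar}(\mathfrak f)}\to\iota$ if for all $\vec a\in\mathcal P(Q)^{\mathrm{ar}(\mathfrak f)}$, $f\vec a\subseteq\{q\mid\delta(q,\mathfrak f)\cap(a_1\times\dots\times a_{\mathrm{ar}(\mathfrak f)}\times\{\ast\}^{N-\mathrm{ar}(\mathfrak f)})\ne\emptyset\}$. Truth relation (by induction on the type): for $f\in\llbracket\vec\rho\to\iota\rrbracket$ and closed $t:\vec\rho\to\iota$, $\Vdash^n f:t:\vec\rho\to\iota$ iff for all $\ell\le n$, all $\vec a\in\llbracket\vec\rho\rrbracket$ and all closed $\vec r:\vec\rho$ with $\Vdash^\ell a_i:r_i:\rho_i$ for all $i$, every $q\in f\vec a$ is such that $\mathfrak A$ has a run up to level $\ell$ on $\mathrm{cn}(t;\vec r)$ starting in $q$. -}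

module Defs where

open import Data.Nat using (ℕ; zero; suc; _≤_; _<ᵇ_; _∸_)
open import Data.Fin using (Fin; toℕ)
open import Data.Fin.Subset using (Subset; _∈_; _⊆_)
open import Data.Bool using (Bool; true; false; _∧_; if_then_else_)
open import Data.List using (List; []; _∷_; allFin)
open import Data.Bool.ListAction using (any)
open import Data.Vec using (Vec; []; _∷_; lookup; tabulate)
open import Data.List.Relation.Unary.All using (All; []; _∷_)
open import Data.Maybe using (Maybe; just; nothing)
open import Data.Product using (Σ; _×_; _,_; proj₁)
open import Data.Unit using (⊤)
open import Data.Empty using (⊥)
open import Relation.Binary.PropositionalEquality using (_≡_; subst)

-- Simple types and contexts (de Bruijn: variable i refers to the i-th
-- entry of the context, innermost binder first)

infixr 5 _⇒_
data Ty : Set where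
  ι   : Ty
  _⇒_ : Ty → Ty → Ty

Ctx : Set
Ctx = List Ty

ιⁿ : ℕ → Ty
ιⁿ zero    = ι
ιⁿ (suc n) = ι ⇒ ιⁿ n

data Var : Ctx → ℕ → Ty → Set where
  here  : ∀ {Γ ρ} → Var (ρ ∷ Γ) zero ρ
  there : ∀ {Γ i ρ σ} → Var Γ i ρ → Var (σ ∷ Γ) (suc i) ρ

lookupV : ∀ {A : Ty → Set} {Γ i ρ} → All A Γ → Var Γ i ρ → A ρ
lookupV (a ∷ _)  here      = a
lookupV (_ ∷ as) (there x) = lookupV as x

-- Labels of the output alphabet Σ = Σ' ∪ {R, β}, Σ' = Fin m

data SLab (m : ℕ) : Set where
  sym : Fin m → SLab m
  R   : SLab m
  β   : SLab m

arS : ∀ {m} → (Fin m → ℕ) → SLab m → ℕ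
arS ar (sym c) = ar c
arS ar R       = 1
arS ar β       = 1

-- Possibly infinite trees are represented as labellings of tree addresses
-- (paths from the root).  Only the addresses reachable from the root
-- (following the arities of the labels) are meaningful.

STree : ℕ → Set
STree m = List ℕ → SLab m

-- Everything else depends on the ranked alphabet Σ' = (Fin m, ar) and the
-- trivial automaton 𝔄 with state set Q = Fin k and transition relation
-- δ q 𝔣 qs = true  iff  (qs , ∗ , … , ∗) ∈ δ(q, 𝔣).

module Theory (m : ℕ) (ar : Fin m → ℕ) (k : ℕ)
              (δ : Fin k → (l : SLab m) → Vec (Fin k) (arS ar l) → Bool) where

  data Lbl : Set where
    var : ℕ → Lbl
    app : Ty → Lbl         -- application s t, annotated with the type of t
    lam : Ty → Lbl
    con : Fin m → Lbl

  data Dir : Set where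
    fun arg body : Dir

  RawTree : Set
  RawTree = List Dir → Lbl

  child : Dir → RawTree → RawTree
  child d t p = t (d ∷ p)

  -- context and type expected at an address (nothing if not reachable)
  ctxAt : Ctx → Ty → RawTree → List Dir → Maybe (Ctx × Ty)
  ctxAt Γ ρ t [] = just (Γ , ρ)
  ctxAt Γ ρ t (d ∷ p) with t [] | d | ρ
  ... | app σ | fun  | _       = ctxAt Γ (σ ⇒ ρ) (child fun t) p
  ... | app σ | arg  | _       = ctxAt Γ σ (child arg t) p
  ... | lam σ | body | _ ⇒ τ   = ctxAt (σ ∷ Γ) τ (child body t) p
  ... | _     | _    | _       = nothing

  NodeOK : Ctx → Ty → Lbl → Set
  NodeOK Δ τ (var i) = Var Δ i τ
  NodeOK Δ τ (app σ) = ⊤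
  NodeOK Δ τ (lam σ) = Σ Ty λ τ' → τ ≡ σ ⇒ τ'
  NodeOK Δ τ (con c) = τ ≡ ιⁿ (ar c)

  WT : Ctx → Ty → RawTree → Set
  WT Γ ρ t = ∀ p {Δ τ} → ctxAt Γ ρ t p ≡ just (Δ , τ) → NodeOK Δ τ (t p)

  Tm : Ctx → Ty → Set
  Tm Γ ρ = Σ RawTree (WT Γ ρ)

  -- Substitution of closed trees for the free variables
  -- sub d ss t : t with free variable (index d + j) replaced by ss[j],
  -- d counting the binders passed so far.

  nth : List RawTree → ℕ → Maybe RawTree
  nth []       _       = nothing
  nth (s ∷ ss) zero    = just s
  nth (s ∷ ss) (suc i) = nth ss i

  sub : ℕ → List RawTree → RawTree → RawTree
  sub d ss t [] with t []
  ... | var i with i <ᵇ d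
  ...   | true  = var i
  ...   | false with nth ss (i ∸ d)
  ...     | just s  = s []
  ...     | nothing = var i
  sub d ss t [] | l = l
  sub d ss t (x ∷ p) with t []
  ... | var i with i <ᵇ d
  ...   | true  = t (x ∷ p)
  ...   | false with nth ss (i ∸ d)
  ...     | just s  = s (x ∷ p)
  ...     | nothing = t (x ∷ p)
  sub d ss t (x ∷ p) | lam _ = sub (suc d) ss (child x t) p
  sub d ss t (x ∷ p) | _     = sub d ss (child x t) p

  raws : ∀ {Γ} → All (Tm []) Γ → List RawTree
  raws []       = []
  raws (t ∷ ts) = proj₁ t ∷ raws ts

  _[_] : ∀ {Γ ρ} → Tm Γ ρ → All (Tm []) Γ → RawTree
  t [ ts ] = sub 0 (raws ts) (proj₁ t)

  -- Continuous normal form  cn(t ; t⃗)  given by its label at each address.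
  -- Branches marked "unreachable" never occur for closed well-typed input.

  cn : RawTree → List RawTree → STree m
  cn t ts [] with t []
  ... | app _ = R
  ... | lam _ = β
  ... | con c = sym c
  ... | var _ = β                         -- unreachable
  cn t ts (i ∷ p) with t []
  ... | app _ = cn (child fun t) (child arg t ∷ ts) p
  ... | lam _ with ts
  ...   | s ∷ ts' = cn (sub 0 (s ∷ []) (child body t)) ts' p
  ...   | []      = β                     -- unreachable
  cn t ts (i ∷ p) | con _ with nth ts i
  ...   | just tᵢ = cn tᵢ [] p            -- child i is tᵢ^β = cn(tᵢ ; ())
  ...   | nothing = β                     -- unreachable
  cn t ts (i ∷ p) | var _ = β             -- unreachable

  Run : ℕ → Fin k → STree m → Set
  Run zero    q T = ⊤
  Run (suc n) q T =
    Σ (Vec (Fin k) (arS ar (T []))) λ qs →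
      (δ q (T []) qs ≡ true) × (∀ (i : Fin (arS ar (T []))) → Run n (lookup qs i) (λ p → T (toℕ i ∷ p)))

  ⟦_⟧ : Ty → Set
  ⟦ ι ⟧     = Subset k
  ⟦ ρ ⇒ σ ⟧ = ⟦ ρ ⟧ → ⟦ σ ⟧

  _⊑_ : ∀ {ρ} → ⟦ ρ ⟧ → ⟦ ρ ⟧ → Set
  _⊑_ {ι}     a b = a ⊆ b
  _⊑_ {ρ ⇒ σ} f g = ∀ (a : ⟦ ρ ⟧) → f a ⊑ g a

  -- lifting along a unary label l ∈ {R, β}:
  -- l(f)(a⃗) = { q | δ(q,l) ∩ (f a⃗ × {∗}^{N-1}) ≠ ∅ }
  liftU : (Fin k → Fin k → Bool) → ∀ ρ → ⟦ ρ ⟧ → ⟦ ρ ⟧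
  liftU d ι       S = tabulate λ q → any (λ q' → d q q' ∧ lookup S q') (allFin k)
  liftU d (ρ ⇒ σ) f = λ a → liftU d σ (f a)

  liftR liftβ : ∀ ρ → ⟦ ρ ⟧ → ⟦ ρ ⟧
  liftR = liftU (λ q q' → δ q R (q' ∷ []))
  liftβ = liftU (λ q q' → δ q β (q' ∷ []))

  appN : ∀ n → ⟦ ιⁿ n ⟧ → Vec (Subset k) n → Subset k
  appN zero    f []       = f
  appN (suc n) f (a ∷ as) = appN n (f a) as

  ConOK : (c : Fin m) → ⟦ ιⁿ (ar c) ⟧ → Set
  ConOK c f = ∀ (as : Vec (Subset k) (ar c)) (q : Fin k) → q ∈ appN (ar c) f as →
    Σ (Vec (Fin k) (ar c)) λ qs → (δ q (sym c) qs ≡ true) × (∀ i → lookup qs i ∈ lookup as i)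

  -- The proof system  ⊢ⁿ_Γ a : t : ρ  (by recursion on n; the rules are
  -- syntax directed, so this is the inductively defined relation)

  Env : Ctx → Set
  Env Γ = All ⟦_⟧ Γ

  ⊢ : ℕ → ∀ {Γ} → Env Γ → (ρ : Ty) → ⟦ ρ ⟧ → RawTree → Set
  ⊢N : ℕ → ∀ {Γ} → Env Γ → (ρ : Ty) → ⟦ ρ ⟧ → RawTree → Lbl → Set

  ⊢ zero    γ ρ a t = ⊤
  ⊢ (suc n) γ ρ a t = ⊢N n γ ρ a t (t [])

  ⊢N n {Γ} γ ρ a t (var i) = Σ (Var Γ i ρ) λ x → a ⊑ lookupV γ x
  ⊢N n γ ρ a t (app σ) =
    Σ ⟦ σ ⇒ ρ ⟧ λ f → Σ ⟦ σ ⟧ λ u →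
      (a ⊑ liftR ρ (f u)) × ⊢ n γ (σ ⇒ ρ) f (child fun t) × ⊢ n γ σ u (child arg t)
  ⊢N n γ ι a t (lam σ) = ⊥
  ⊢N n γ (ρ ⇒ σ) f t (lam _) =
    ∀ (a : ⟦ ρ ⟧) → Σ ⟦ σ ⟧ λ b → (f a ⊑ liftβ σ b) × ⊢ n (a ∷ γ) σ b (child body t)
  ⊢N n γ ρ f t (con c) = Σ (ρ ≡ ιⁿ (ar c)) λ e → ConOK c (subst ⟦_⟧ e f)

  ⊩ : ℕ → (ρ : Ty) → ⟦ ρ ⟧ → RawTree → Set
  ⊩Args : ℕ → (ρ : Ty) → ⟦ ρ ⟧ → (List RawTree → STree m) → Set

  ⊩ n ρ f t = ∀ ℓ → ℓ ≤ n → ⊩Args ℓ ρ f (cn t)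

  ⊩Args ℓ ι S K = ∀ q → q ∈ S → Run ℓ q (K [])
  ⊩Args ℓ (ρ ⇒ σ) f K =
    ∀ (a : ⟦ ρ ⟧) (r : Tm [] ρ) → ⊩ ℓ ρ a (proj₁ r) → ⊩Args ℓ σ (f a) (λ rs → K (proj₁ r ∷ rs))

-- By induction on n, reading off the root of cn(t[ts]). A variable is the hypothesis on ts.
-- An application s u yields an R-node above cn(s[ts]; u[ts], ...); since a ⊑ R(f u), one
-- automaton step through R reduces the claim to the hypothesis for s, applied to the closed
-- well-typed argument u[ts], which the hypothesis for u relates to u. An abstraction yields a
-- β-node above the instantiated body; because the ts are closed, instantiating the body of
-- (λx.s)[ts] with r gives s[r, ts], to which the hypothesis for s in the extended context
-- applies. A constant is rule (v) applied to the truth of its arguments.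

module Submission where

open import Defs
open import Data.Bool using (Bool; true; false)
open import Data.Bool.Properties using (T-≡; T-∧; ¬-not)
open import Data.Empty using (⊥)
open import Data.Fin using (Fin; toℕ; zero; suc)
open import Data.Fin.Subset using (_∈_)
open import Data.List using (List; []; _∷_; _++_; length; allFin)
open import Data.List.Relation.Binary.Pointwise using (Pointwise; []; _∷_)
import Data.List.Relation.Binary.Pointwise as Pointwiseᴸ
open import Data.List.Relation.Unary.All using (All; []; _∷_)
import Data.List.Relation.Unary.Any as Any
open import Data.List.Relation.Unary.Any.Properties using (any⁻)
open import Data.Maybe using (just; nothing)
import Data.Maybe.Relation.Binary.Pointwise as Pointwiseᴹ
open import Data.Nat using (ℕ; zero; suc; _+_; _≤_; _<_; _<ᵇ_; _∸_; z≤n; s≤s)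
open import Data.Nat.Properties
  using (<⇒<ᵇ; <ᵇ⇒<; <⇒≱; _<?_; ≮⇒≥; m≤m+n; m+n∸m≡n; <-≤-trans; <-cmp; m≤n⇒m≤1+n; n<1+n;
         ≤-refl; n∸n≡0; <⇒≤; +-∸-assoc; ≤-trans; n≤1+n)
open import Data.Product using (Σ; _×_; _,_; proj₁; proj₂)
open import Data.Sum using (_⊎_; inj₁; inj₂)
open import Data.Unit using (⊤; tt)
open import Data.Vec using (Vec; _∷_; []; lookup; toList)
open import Data.Vec.Properties using (lookup∘tabulate; []=⇒lookup; lookup⇒[]=)
import Data.Vec.Relation.Binary.Pointwise.Inductive as Pointwiseⱽ
open Pointwiseⱽ using ([]; _∷_) renaming (Pointwise to Pointwiseⱽ)
open import Function.Base using (_∘_; case_of_)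
open import Function.Bundles using (Equivalence)
open import Relation.Binary.Bundles using (Setoid)
open import Relation.Binary.Definitions using (tri<; tri≈; tri>)
open import Relation.Binary.PropositionalEquality using (_≡_; refl; cong; subst; _≗_)
import Relation.Binary.PropositionalEquality as ≡
import Relation.Binary.Reasoning.Setoid as SetoidReasoning
open import Relation.Nullary using (yes; no)

module Soundness (m : ℕ) (ar : Fin m → ℕ) (k : ℕ)
                 (δ : Fin k → (l : SLab m) → Vec (Fin k) (arS ar l) → Bool) where
  open Theory m ar k δ

  -- Agreement of trees along paths

  -- Below a variable or a constant the labelling of a raw tree is junk that sub may still
  -- rewrite, so trees are compared only along the edges a well-typed tree can follow.
  Edge : Lbl → Dir → Set
  Edge (app _) fun  = ⊤
  Edge (app _) arg  = ⊤
  Edge (lam _) body = ⊤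
  Edge _       _    = ⊥

  Path : RawTree → List Dir → Set
  Path t []      = ⊤
  Path t (d ∷ p) = Edge (t []) d × Path (child d t) p

  infix 4 _≈_
  _≈_ : RawTree → RawTree → Set
  t ≈ t' = ∀ p → Path t p → t p ≡ t' p

  edge-along : ∀ {l l' d} → l ≡ l' → Edge l d → Edge l' d
  edge-along {d = d} = subst (λ l → Edge l d)

  ≈-child : ∀ {t t' l} d → t ≈ t' → t [] ≡ l → Edge l d → child d t ≈ child d t'
  ≈-child d e et ed p pa = e (d ∷ p) (edge-along (≡.sym et) ed , pa)

  ≈-refl : ∀ {t} → t ≈ t
  ≈-refl _ _ = refl

  ≈-sym : ∀ {t t'} → t ≈ t' → t' ≈ t
  ≈-sym e []      _         = ≡.sym (e [] tt)
  ≈-sym e (d ∷ p) (ed , pa) = ≈-sym (≈-child d e refl (edge-along (≡.sym (e [] tt)) ed)) p pa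

  Path-resp-≈ : ∀ {t t'} → t ≈ t' → ∀ p → Path t p → Path t' p
  Path-resp-≈ e []      _         = tt
  Path-resp-≈ e (d ∷ p) (ed , pa) = edge-along (e [] tt) ed , Path-resp-≈ (≈-child d e refl ed) p pa

  ≈-trans : ∀ {t t' t''} → t ≈ t' → t' ≈ t'' → t ≈ t''
  ≈-trans e e' p pa = ≡.trans (e p pa) (e' p (Path-resp-≈ e p pa))

  ≗⇒≈ : ∀ {t t'} → t ≗ t' → t ≈ t'
  ≗⇒≈ e p _ = e p

  ≈-setoid : Setoid _ _
  ≈-setoid = record
    { Carrier = RawTree ; _≈_ = _≈_
    ; isEquivalence = record { refl = ≈-refl ; sym = ≈-sym ; trans = ≈-trans } }

  Compound : Lbl → Set
  Compound (var _) = ⊥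
  Compound _       = ⊤

  under : Lbl → ℕ → ℕ
  under (lam _) d = suc d
  under _       d = d

  under-suc : ∀ l d → under l (suc d) ≡ suc (under l d)
  under-suc (var _) d = refl
  under-suc (app _) d = refl
  under-suc (lam _) d = refl
  under-suc (con _) d = refl

  sub-root : ∀ d ss t {l} → t [] ≡ l → {Compound l} → sub d ss t [] ≡ l
  sub-root d ss t {app _} et rewrite et = refl
  sub-root d ss t {lam _} et rewrite et = refl
  sub-root d ss t {con _} et rewrite et = refl

  sub-child : ∀ d ss t {l} x → t [] ≡ l → {Compound l} →
              child x (sub d ss t) ≗ sub (under l d) ss (child x t)
  sub-child d ss t {app _} x et p rewrite et = refl
  sub-child d ss t {lam _} x et p rewrite et = refl
  sub-child d ss t {con _} x et p rewrite et = refl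

  Path-sub-child : ∀ d ss t {l} x p → t [] ≡ l → {Compound l} →
                   Path (sub d ss t) (x ∷ p) → Edge l x × Path (sub (under l d) ss (child x t)) p
  Path-sub-child d ss t x p et {c} (ed , pa) =
    edge-along (sub-root d ss t et {c}) ed , Path-resp-≈ (≗⇒≈ (sub-child d ss t x et {c})) p pa

  <ᵇ-true : ∀ {i d} → i < d → (i <ᵇ d) ≡ true
  <ᵇ-true i<d = Equivalence.to T-≡ (<⇒<ᵇ i<d)

  <ᵇ-false : ∀ {i d} → d ≤ i → (i <ᵇ d) ≡ false
  <ᵇ-false d≤i = ¬-not λ i<ᵇd → <⇒≱ (<ᵇ⇒< _ _ (Equivalence.from T-≡ i<ᵇd)) d≤i

  sub-bound : ∀ d ss t {i} → t [] ≡ var i → i < d → sub d ss t ≗ t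
  sub-bound d ss t et i<d []      rewrite et | <ᵇ-true i<d = refl
  sub-bound d ss t et i<d (x ∷ p) rewrite et | <ᵇ-true i<d = refl

  sub-free : ∀ d ss t {i s} → t [] ≡ var i → d ≤ i → nth ss (i ∸ d) ≡ just s → sub d ss t ≗ s
  sub-free d ss t et d≤i hit []      rewrite et | <ᵇ-false d≤i | hit = refl
  sub-free d ss t et d≤i hit (x ∷ p) rewrite et | <ᵇ-false d≤i | hit = refl

  sub-unassigned : ∀ d ss t {i} → t [] ≡ var i → d ≤ i → nth ss (i ∸ d) ≡ nothing → sub d ss t ≗ t
  sub-unassigned d ss t et d≤i miss []      rewrite et | <ᵇ-false d≤i | miss = refl
  sub-unassigned d ss t et d≤i miss (x ∷ p) rewrite et | <ᵇ-false d≤i | miss = refl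

  nth-resp : ∀ {R : RawTree → RawTree → Set} {ss ss'} → Pointwise R ss ss' →
             ∀ i → Pointwiseᴹ.Pointwise R (nth ss i) (nth ss' i)
  nth-resp []       i       = Pointwiseᴹ.nothing
  nth-resp (e ∷ _)  zero    = Pointwiseᴹ.just e
  nth-resp (_ ∷ es) (suc i) = nth-resp es i

  sub-resp-≈-node : ∀ {t t' ss ss' l} → t ≈ t' → Pointwise _≈_ ss ss' →
                    t [] ≡ l → t' [] ≡ l → {Compound l} →
                    ∀ d p → Path (sub d ss t) p → sub d ss t p ≡ sub d ss' t' p

  sub-resp-≈ : ∀ {t t' ss ss'} → t ≈ t' → Pointwise _≈_ ss ss' → ∀ d → sub d ss t ≈ sub d ss' t'
  sub-resp-≈ {t} {t'} {ss} {ss'} e es d p pa with t [] in et | t' [] in et' | e [] tt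
  ... | var i | .(var i) | refl with i <? d
  ...   | yes i<d = (begin
          sub d ss t   ≈⟨ ≗⇒≈ (sub-bound d ss t et i<d) ⟩
          t            ≈⟨ e ⟩
          t'           ≈⟨ ≗⇒≈ (sub-bound d ss' t' et' i<d) ⟨
          sub d ss' t' ∎) p pa
    where open SetoidReasoning ≈-setoid
  ...   | no i≮d with nth ss (i ∸ d) in hit | nth ss' (i ∸ d) in hit' | nth-resp es (i ∸ d)
  ...     | just s | just s' | Pointwiseᴹ.just e'' = (begin
            sub d ss t   ≈⟨ ≗⇒≈ (sub-free d ss t et (≮⇒≥ i≮d) hit) ⟩
            s            ≈⟨ e'' ⟩
            s'           ≈⟨ ≗⇒≈ (sub-free d ss' t' et' (≮⇒≥ i≮d) hit') ⟨
            sub d ss' t' ∎) p pa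
    where open SetoidReasoning ≈-setoid
  ...     | nothing | nothing | Pointwiseᴹ.nothing = (begin
            sub d ss t   ≈⟨ ≗⇒≈ (sub-unassigned d ss t et (≮⇒≥ i≮d) hit) ⟩
            t            ≈⟨ e ⟩
            t'           ≈⟨ ≗⇒≈ (sub-unassigned d ss' t' et' (≮⇒≥ i≮d) hit') ⟨
            sub d ss' t' ∎) p pa
    where open SetoidReasoning ≈-setoid
  sub-resp-≈ e es d p pa | app _ | _ | refl = sub-resp-≈-node e es et et' d p pa
  sub-resp-≈ e es d p pa | lam _ | _ | refl = sub-resp-≈-node e es et et' d p pa
  sub-resp-≈ e es d p pa | con _ | _ | refl = sub-resp-≈-node e es et et' d p pa

  sub-resp-≈-node {t} {t'} {ss} {ss'} e es et et' {c} d [] _ =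
    ≡.trans (sub-root d ss t et {c}) (≡.sym (sub-root d ss' t' et' {c}))
  sub-resp-≈-node {t} {t'} {ss} {ss'} {l} e es et et' {c} d (x ∷ p) pa = begin
    sub d ss t (x ∷ p)                 ≡⟨ sub-child d ss t x et {c} p ⟩
    sub (under l d) ss (child x t) p   ≡⟨ sub-resp-≈ (≈-child x e et (proj₁ below)) es (under l d) p (proj₂ below) ⟩
    sub (under l d) ss' (child x t') p ≡⟨ sub-child d ss' t' x et' {c} p ⟨
    sub d ss' t' (x ∷ p)               ∎
    where
    open ≡.≡-Reasoning
    below : Edge l x × Path (sub (under l d) ss (child x t)) p
    below = Path-sub-child d ss t x p et {c} pa

  -- Typing of infinite trees

  Children : (Ctx → Ty → RawTree → Set) → Ctx → Ty → RawTree → Lbl → Set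
  Children J Γ ρ       t (app σ) = J Γ (σ ⇒ ρ) (child fun t) × J Γ σ (child arg t)
  Children J Γ (_ ⇒ τ) t (lam σ) = J (σ ∷ Γ) τ (child body t)
  Children J _ _       _ _       = ⊤

  -- WT is the largest relation respecting the node rule, so it contains every relation that does.
  WT-coind : ∀ {J : Ctx → Ty → RawTree → Set} →
             (∀ {Γ ρ t} → J Γ ρ t → NodeOK Γ ρ (t []) × Children J Γ ρ t (t [])) →
             ∀ {Γ ρ t} → J Γ ρ t → WT Γ ρ t
  WT-coind step r []      refl = proj₁ (step r)
  WT-coind {J} step {Γ} {ρ} {t} r (x ∷ p) h with t [] | x | ρ | proj₂ (step r)
  ... | app σ | fun  | _     | rf , _ = WT-coind {J} step rf p h
  ... | app σ | arg  | _     | _ , ra = WT-coind {J} step ra p h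
  ... | lam σ | body | _ ⇒ _ | rb     = WT-coind {J} step rb p h
  ... | app _ | body | _     | _      = case h of λ ()
  ... | lam _ | fun  | _     | _      = case h of λ ()
  ... | lam _ | arg  | _     | _      = case h of λ ()
  ... | lam _ | body | ι     | _      = case h of λ ()
  ... | var _ | _    | _     | _      = case h of λ ()
  ... | con _ | _    | _     | _      = case h of λ ()

  ctxAt-fun : ∀ {Γ ρ t σ} p → t [] ≡ app σ → ctxAt Γ ρ t (fun ∷ p) ≡ ctxAt Γ (σ ⇒ ρ) (child fun t) p
  ctxAt-fun p et rewrite et = refl

  ctxAt-arg : ∀ {Γ ρ t σ} p → t [] ≡ app σ → ctxAt Γ ρ t (arg ∷ p) ≡ ctxAt Γ σ (child arg t) p
  ctxAt-arg p et rewrite et = refl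

  ctxAt-body : ∀ {Γ ρ τ t σ} p → t [] ≡ lam σ → ctxAt Γ (ρ ⇒ τ) t (body ∷ p) ≡ ctxAt (σ ∷ Γ) τ (child body t) p
  ctxAt-body p et rewrite et = refl

  WT-root : ∀ {Γ ρ t l} → WT Γ ρ t → t [] ≡ l → NodeOK Γ ρ l
  WT-root w et = subst (NodeOK _ _) et (w [] refl)

  WT-children : ∀ {Γ ρ t l} → WT Γ ρ t → t [] ≡ l → Children WT Γ ρ t l
  WT-children {t = t} {app _} w et = (λ p → w (fun ∷ p) ∘ ≡.trans (ctxAt-fun {t = t} p et))
                                   , (λ p → w (arg ∷ p) ∘ ≡.trans (ctxAt-arg {t = t} p et))
  WT-children {ρ = ι}             {l = lam _} w et = tt
  WT-children {ρ = _ ⇒ _} {t = t} {l = lam _} w et = λ p → w (body ∷ p) ∘ ≡.trans (ctxAt-body {t = t} p et)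
  WT-children {l = var _} w et = tt
  WT-children {l = con _} w et = tt

  WT-resp-≗ : ∀ {Γ ρ t t'} → t ≗ t' → WT Γ ρ t → WT Γ ρ t'
  WT-resp-≗ e w = WT-coind {J = Agreeing} step (_ , e , w)
    where
    Agreeing : Ctx → Ty → RawTree → Set
    Agreeing Γ ρ t' = Σ RawTree λ t → t ≗ t' × WT Γ ρ t

    along : ∀ {Γ ρ t t'} → (∀ x → child x t ≗ child x t') →
            ∀ l → Children WT Γ ρ t l → Children Agreeing Γ ρ t' l
    along e (app _) (wf , wa)        = (_ , e fun , wf) , (_ , e arg , wa)
    along {ρ = _ ⇒ _} e (lam _) wb  = _ , e body , wb
    along {ρ = ι}     e (lam _) _   = tt
    along e (var _) _ = tt
    along e (con _) _ = tt

    step : ∀ {Γ ρ t'} → Agreeing Γ ρ t' → NodeOK Γ ρ (t' []) × Children Agreeing Γ ρ t' (t' [])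
    step {Γ} {ρ} {t'} (t , e , w) =
      subst (NodeOK Γ ρ) (e []) (WT-root w refl) ,
      subst (Children Agreeing Γ ρ t') (e []) (along (λ x p → e (x ∷ p)) (t []) (WT-children w refl))

  Var-weaken : ∀ {Γ i ρ} Ξ → Var Γ i ρ → Var (Γ ++ Ξ) i ρ
  Var-weaken Ξ here      = here
  Var-weaken Ξ (there x) = there (Var-weaken Ξ x)

  Var-index< : ∀ {Γ i ρ} → Var Γ i ρ → i < length Γ
  Var-index< here      = s≤s z≤n
  Var-index< (there x) = s≤s (Var-index< x)

  data VarOf++ (Ξ Γ : Ctx) : ℕ → Ty → Set where
    inner : ∀ {i ρ} → Var Ξ i ρ → VarOf++ Ξ Γ i ρ
    outer : ∀ {j ρ} → Var Γ j ρ → VarOf++ Ξ Γ (length Ξ + j) ρ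

  Var-split : ∀ Ξ {Γ i ρ} → Var (Ξ ++ Γ) i ρ → VarOf++ Ξ Γ i ρ
  Var-split []      x         = outer x
  Var-split (σ ∷ Ξ) here      = inner here
  Var-split (σ ∷ Ξ) (there x) with Var-split Ξ x
  ... | inner y = inner (there y)
  ... | outer y = outer y

  WT-weaken : ∀ {Γ ρ s} Ξ → WT Γ ρ s → WT (Γ ++ Ξ) ρ s
  WT-weaken {Γ} Ξ w = WT-coind {J = Weakened} step (Γ , refl , w)
    where
    Weakened : Ctx → Ty → RawTree → Set
    Weakened Δ ρ s = Σ Ctx λ Γ → Γ ++ Ξ ≡ Δ × WT Γ ρ s

    node : ∀ {Γ ρ} l → NodeOK Γ ρ l → NodeOK (Γ ++ Ξ) ρ l
    node (var _) x = Var-weaken Ξ x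
    node (app _) n = n
    node (lam _) n = n
    node (con _) n = n

    children : ∀ {Γ ρ s} l → Children WT Γ ρ s l → Children Weakened (Γ ++ Ξ) ρ s l
    children {Γ} (app _) (wf , wa)          = (Γ , refl , wf) , (Γ , refl , wa)
    children {Γ} {_ ⇒ _} (lam σ) wb         = σ ∷ Γ , refl , wb
    children {ρ = ι}     (lam _) _          = tt
    children (var _) _ = tt
    children (con _) _ = tt

    step : ∀ {Δ ρ s} → Weakened Δ ρ s → NodeOK Δ ρ (s []) × Children Weakened Δ ρ s (s [])
    step {s = s} (Γ , refl , w) = node (s []) (WT-root w refl) , children (s []) (WT-children w refl)

  WT-var : ∀ {Γ ρ t i} → t [] ≡ var i → Var Γ i ρ → WT Γ ρ t
  WT-var et x = WT-coind {J = VarNode} step (varNode et x)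
    where
    data VarNode (Γ : Ctx) (ρ : Ty) (t : RawTree) : Set where
      varNode : ∀ {i} → t [] ≡ var i → Var Γ i ρ → VarNode Γ ρ t

    step : ∀ {Γ ρ t} → VarNode Γ ρ t → NodeOK Γ ρ (t []) × Children VarNode Γ ρ t (t [])
    step {Γ} {ρ} {t} (varNode et x) =
      subst (NodeOK Γ ρ) (≡.sym et) x , subst (Children VarNode Γ ρ t) (≡.sym et) tt

  nth-raws : ∀ {Γ j ρ} (ts : All (Tm []) Γ) (x : Var Γ j ρ) →
             nth (raws ts) j ≡ just (proj₁ (lookupV ts x))
  nth-raws (t ∷ ts) here      = refl
  nth-raws (t ∷ ts) (there x) = nth-raws ts x

  WT-sub : ∀ Ξ {Γ ρ t} (ts : All (Tm []) Γ) → WT (Ξ ++ Γ) ρ t → WT Ξ ρ (sub (length Ξ) (raws ts) t)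
  WT-sub Ξ {Γ} {t = t} ts w = WT-coind {J = Substituted} step (inj₂ (t , (λ _ → refl) , w))
    where
    Substituted : Ctx → Ty → RawTree → Set
    Substituted Ξ ρ T = WT Ξ ρ T ⊎ Σ RawTree λ t → T ≗ sub (length Ξ) (raws ts) t × WT (Ξ ++ Γ) ρ t

    Step : Ctx → Ty → RawTree → Lbl → Set
    Step Ξ ρ T l = NodeOK Ξ ρ l × Children Substituted Ξ ρ T l

    typed-children : ∀ {Ξ ρ T} l → Children WT Ξ ρ T l → Children Substituted Ξ ρ T l
    typed-children (app _) (wf , wa)       = inj₁ wf , inj₁ wa
    typed-children {ρ = _ ⇒ _} (lam _) wb = inj₁ wb
    typed-children {ρ = ι}     (lam _) _  = tt
    typed-children (var _) _ = tt
    typed-children (con _) _ = tt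

    typed : ∀ {Ξ ρ T} → WT Ξ ρ T → Step Ξ ρ T (T [])
    typed {T = T} w = WT-root w refl , typed-children (T []) (WT-children w refl)

    step : ∀ {Ξ ρ T} → Substituted Ξ ρ T → Step Ξ ρ T (T [])
    step (inj₁ w) = typed w
    step {Ξ} {ρ} {T} (inj₂ (t , e , w)) with t [] in et
    ... | var i with Var-split Ξ (WT-root w et)
    ...   | inner x = typed (WT-resp-≗ (λ p → ≡.sym (≡.trans (e p) (sub-bound _ _ t et (Var-index< x) p)))
                                        (WT-var et x))
    ...   | outer {j} x = typed (WT-resp-≗ (λ p → ≡.sym (≡.trans (e p) (sub-free _ _ t et (m≤m+n _ j) hit p)))
                                            (WT-weaken Ξ (proj₂ (lookupV ts x))))
      where
      hit : nth (raws ts) (length Ξ + j ∸ length Ξ) ≡ just (proj₁ (lookupV ts x))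
      hit = ≡.trans (cong (nth (raws ts)) (m+n∸m≡n (length Ξ) j)) (nth-raws ts x)
    step {Ξ} {ρ} {T} (inj₂ (t , e , w)) | app σ =
      subst (Step Ξ ρ T) (≡.sym root)
        (tt , inj₂ (_ , below fun , proj₁ (WT-children w et)) , inj₂ (_ , below arg , proj₂ (WT-children w et)))
      where
      root : T [] ≡ app σ
      root = ≡.trans (e []) (sub-root _ _ t et)
      below : ∀ x → child x T ≗ sub (length Ξ) (raws ts) (child x t)
      below x p = ≡.trans (e (x ∷ p)) (sub-child _ _ t x et p)
    step {Ξ} {ρ} {T} (inj₂ (t , e , w)) | lam σ with WT-root w et
    ...   | τ , refl = subst (Step Ξ ρ T) (≡.sym root) ((τ , refl) , inj₂ (_ , below , WT-children w et))
      where
      root : T [] ≡ lam σ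
      root = ≡.trans (e []) (sub-root _ _ t et)
      below : child body T ≗ sub (suc (length Ξ)) (raws ts) (child body t)
      below p = ≡.trans (e (body ∷ p)) (sub-child _ _ t body et p)
    step {Ξ} {ρ} {T} (inj₂ (t , e , w)) | con c = subst (Step Ξ ρ T) (≡.sym root) (WT-root w et , tt)
      where
      root : T [] ≡ con c
      root = ≡.trans (e []) (sub-root _ _ t et)

  -- Closed trees and fusion of substitutions

  scope : Lbl → Ctx → Ctx
  scope (lam σ) Γ = σ ∷ Γ
  scope _       Γ = Γ

  scope-length≤ : ∀ {Γ d} l → length Γ ≤ d → length (scope l Γ) ≤ under l d
  scope-length≤ (var _) le = le
  scope-length≤ (app _) le = le
  scope-length≤ (lam _) le = s≤s le
  scope-length≤ (con _) le = le

  WT-child : ∀ {Γ ρ t l} x → WT Γ ρ t → t [] ≡ l → Edge l x → Σ Ty λ τ → WT (scope l Γ) τ (child x t)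
  WT-child {l = app _} fun  w et _ = _ , proj₁ (WT-children w et)
  WT-child {l = app _} arg  w et _ = _ , proj₂ (WT-children w et)
  WT-child {l = lam _} body w et _ with WT-root w et
  ... | _ , refl = _ , WT-children w et

  Closed : RawTree → Set
  Closed s = ∀ d ss → sub d ss s ≈ s

  sub-closed-node : ∀ {Γ ρ t l} → WT Γ ρ t → t [] ≡ l → {Compound l} →
                    ∀ d → length Γ ≤ d → ∀ ss p → Path (sub d ss t) p → sub d ss t p ≡ t p

  sub-closed : ∀ {Γ ρ t} → WT Γ ρ t → ∀ d → length Γ ≤ d → ∀ ss → sub d ss t ≈ t
  sub-closed {t = t} w d le ss p pa with t [] in et
  ... | var i = sub-bound d ss t et (<-≤-trans (Var-index< (WT-root w et)) le) p
  ... | app _ = sub-closed-node w et d le ss p pa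
  ... | lam _ = sub-closed-node w et d le ss p pa
  ... | con _ = sub-closed-node w et d le ss p pa

  sub-closed-node {t = t} w et {c} d le ss [] _ = ≡.trans (sub-root d ss t et {c}) (≡.sym et)
  sub-closed-node {t = t} {l} w et {c} d le ss (x ∷ p) pa =
    let ed , pa' = Path-sub-child d ss t x p et {c} pa
    in ≡.trans (sub-child d ss t x et {c} p)
               (sub-closed (proj₂ (WT-child x w et ed)) (under l d) (scope-length≤ l le) ss p pa')

  WT⇒Closed : ∀ {ρ s} → WT [] ρ s → Closed s
  WT⇒Closed w d = sub-closed w d z≤n

  All-nth : ∀ {P : RawTree → Set} {ss s} j → All P ss → nth ss j ≡ just s → P s
  All-nth zero    (ps ∷ _)   refl = ps
  All-nth (suc j) (_  ∷ pss) hit  = All-nth j pss hit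

  nth-∷-∸ : ∀ r rs {d i} → d < i → nth (r ∷ rs) (i ∸ d) ≡ nth rs (i ∸ suc d)
  nth-∷-∸ r rs (s≤s d≤i) = cong (nth (r ∷ rs)) (+-∸-assoc 1 d≤i)

  -- The trees in ss are closed, so substituting r into them afterwards has no effect.
  sub-fuse-node : ∀ r {ss} → All Closed ss → ∀ {t l} → t [] ≡ l → {Compound l} →
                  ∀ d p → Path (sub d (r ∷ []) (sub (suc d) ss t)) p →
                  sub d (r ∷ []) (sub (suc d) ss t) p ≡ sub d (r ∷ ss) t p

  sub-fuse : ∀ r {ss} → All Closed ss → ∀ d t → sub d (r ∷ []) (sub (suc d) ss t) ≈ sub d (r ∷ ss) t
  sub-fuse r {ss} closed d t p pa with t [] in et
  ... | app _ = sub-fuse-node r closed et d p pa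
  ... | lam _ = sub-fuse-node r closed et d p pa
  ... | con _ = sub-fuse-node r closed et d p pa
  ... | var i with <-cmp i d
  ...   | tri< i<d _ _ = (begin
          sub d (r ∷ []) (sub (suc d) ss t) ≈⟨ ≗⇒≈ (sub-bound d _ _ (≡.trans (reduced []) et) i<d) ⟩
          sub (suc d) ss t                  ≈⟨ ≗⇒≈ reduced ⟩
          t                                 ≈⟨ ≗⇒≈ (sub-bound d (r ∷ ss) t et i<d) ⟨
          sub d (r ∷ ss) t                  ∎) p pa
    where
    open SetoidReasoning ≈-setoid
    reduced : sub (suc d) ss t ≗ t
    reduced = sub-bound (suc d) ss t et (m≤n⇒m≤1+n i<d)
  ...   | tri≈ _ refl _ = (begin
          sub i (r ∷ []) (sub (suc i) ss t) ≈⟨ ≗⇒≈ (sub-free i _ _ (≡.trans (reduced []) et) ≤-refl hit) ⟩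
          r                                 ≈⟨ ≗⇒≈ (sub-free i (r ∷ ss) t et ≤-refl hit) ⟨
          sub i (r ∷ ss) t                  ∎) p pa
    where
    open SetoidReasoning ≈-setoid
    reduced : sub (suc i) ss t ≗ t
    reduced = sub-bound (suc i) ss t et (n<1+n i)
    hit : ∀ {rs} → nth (r ∷ rs) (i ∸ i) ≡ just r
    hit {rs} = cong (nth (r ∷ rs)) (n∸n≡0 i)
  ...   | tri> _ _ d<i with nth ss (i ∸ suc d) in hit
  ...     | just s = (begin
            sub d (r ∷ []) (sub (suc d) ss t) ≈⟨ sub-resp-≈ (≗⇒≈ reduced) (≈-refl ∷ []) d ⟩
            sub d (r ∷ []) s                  ≈⟨ All-nth (i ∸ suc d) closed hit d (r ∷ []) ⟩
            s                                 ≈⟨ ≗⇒≈ (sub-free d (r ∷ ss) t et (<⇒≤ d<i) (≡.trans (nth-∷-∸ r ss d<i) hit)) ⟨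
            sub d (r ∷ ss) t                  ∎) p pa
    where
    open SetoidReasoning ≈-setoid
    reduced : sub (suc d) ss t ≗ s
    reduced = sub-free (suc d) ss t et d<i hit
  ...     | nothing = (begin
            sub d (r ∷ []) (sub (suc d) ss t) ≈⟨ ≗⇒≈ (sub-unassigned d _ _ (≡.trans (reduced []) et) (<⇒≤ d<i) (nth-∷-∸ r [] d<i)) ⟩
            sub (suc d) ss t                  ≈⟨ ≗⇒≈ reduced ⟩
            t                                 ≈⟨ ≗⇒≈ (sub-unassigned d (r ∷ ss) t et (<⇒≤ d<i) (≡.trans (nth-∷-∸ r ss d<i) hit)) ⟨
            sub d (r ∷ ss) t                  ∎) p pa
    where
    open SetoidReasoning ≈-setoid
    reduced : sub (suc d) ss t ≗ t
    reduced = sub-unassigned (suc d) ss t et d<i hit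

  sub-fuse-node r {ss} closed {t} et {c} d [] _ =
    ≡.trans (sub-root d (r ∷ []) (sub (suc d) ss t) (sub-root (suc d) ss t et {c}) {c})
            (≡.sym (sub-root d (r ∷ ss) t et {c}))
  sub-fuse-node r {ss} closed {t} {l} et {c} d (x ∷ p) pa = begin
    sub d (r ∷ []) T (x ∷ p)                                      ≡⟨ sub-child d (r ∷ []) T x eT {c} p ⟩
    sub (under l d) (r ∷ []) (child x T) p                        ≡⟨ pushed p pa' ⟩
    sub (under l d) (r ∷ []) (sub (suc (under l d)) ss (child x t)) p
      ≡⟨ sub-fuse r closed (under l d) (child x t) p (Path-resp-≈ pushed p pa') ⟩
    sub (under l d) (r ∷ ss) (child x t) p                        ≡⟨ sub-child d (r ∷ ss) t x et {c} p ⟨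
    sub d (r ∷ ss) t (x ∷ p)                                      ∎
    where
    open ≡.≡-Reasoning
    T : RawTree
    T = sub (suc d) ss t
    eT : T [] ≡ l
    eT = sub-root (suc d) ss t et {c}
    pa' : Path (sub (under l d) (r ∷ []) (child x T)) p
    pa' = proj₂ (Path-sub-child d (r ∷ []) T x p eT {c} pa)
    below : child x T ≗ sub (suc (under l d)) ss (child x t)
    below q = ≡.trans (sub-child (suc d) ss t x et {c} q) (cong (λ e → sub e ss (child x t) q) (under-suc l d))
    pushed : sub (under l d) (r ∷ []) (child x T) ≈ sub (under l d) (r ∷ []) (sub (suc (under l d)) ss (child x t))
    pushed = sub-resp-≈ (≗⇒≈ below) (≈-refl ∷ []) (under l d)

  -- Continuous normal forms and runs

  cn-resp-≈ : ∀ {t t' ts ts'} → t ≈ t' → Pointwise _≈_ ts ts' → cn t ts ≗ cn t' ts'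
  cn-resp-≈ e es [] rewrite e [] tt = refl
  cn-resp-≈ {t} {t'} {ts} {ts'} e es (i ∷ p) with t [] in et | t' [] | e [] tt
  ... | var _ | _ | refl = refl
  ... | app _ | _ | refl = cn-resp-≈ (≈-child fun e et tt) (≈-child arg e et tt ∷ es) p
  ... | lam _ | _ | refl with ts | ts' | es
  ...   | []    | []    | []       = refl
  ...   | _ ∷ _ | _ ∷ _ | e' ∷ es' = cn-resp-≈ (sub-resp-≈ (≈-child body e et tt) (e' ∷ []) 0) es' p
  cn-resp-≈ {t} {t'} {ts} {ts'} e es (i ∷ p) | con _ | _ | refl with nth ts i | nth ts' i | nth-resp es i
  ... | just _  | just _  | Pointwiseᴹ.just e' = cn-resp-≈ e' [] p
  ... | nothing | nothing | Pointwiseᴹ.nothing = refl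

  cn-app : ∀ {T σ} → T [] ≡ app σ → ∀ ts →
           cn T ts [] ≡ R × (∀ i p → cn T ts (i ∷ p) ≡ cn (child fun T) (child arg T ∷ ts) p)
  cn-app et ts rewrite et = refl , λ _ _ → refl

  cn-lam : ∀ {T σ} → T [] ≡ lam σ → ∀ ts →
           cn T ts [] ≡ β × (∀ s i p → cn T (s ∷ ts) (i ∷ p) ≡ cn (sub 0 (s ∷ []) (child body T)) ts p)
  cn-lam et ts rewrite et = refl , λ _ _ _ → refl

  cn-con : ∀ {T c} → T [] ≡ con c → ∀ ts →
           cn T ts [] ≡ sym c × (∀ {s} i p → nth ts i ≡ just s → cn T ts (i ∷ p) ≡ cn s [] p)
  cn-con {T} {c} et ts = root , below
    where
    root : cn T ts [] ≡ sym c
    root rewrite et = refl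
    below : ∀ {s} i p → nth ts i ≡ just s → cn T ts (i ∷ p) ≡ cn s [] p
    below i p hit rewrite et | hit = refl

  Run-resp-≗ : ∀ {ℓ q T T'} → T ≗ T' → Run ℓ q T → Run ℓ q T'
  Run-resp-≗ {zero}  e _ = tt
  Run-resp-≗ {suc ℓ} {T = T} e (qs , d , rs) rewrite ≡.sym (e []) =
    qs , d , λ i → Run-resp-≗ (λ p → e (toℕ i ∷ p)) (rs i)

  ⊩Args-resp-≗ : ∀ {ℓ} ρ {f K K'} → (∀ rs → K rs ≗ K' rs) → ⊩Args ℓ ρ f K → ⊩Args ℓ ρ f K'
  ⊩Args-resp-≗ ι       e h q q∈     = Run-resp-≗ (e []) (h q q∈)
  ⊩Args-resp-≗ (ρ ⇒ σ) e h a r hr = ⊩Args-resp-≗ σ (λ rs → e (proj₁ r ∷ rs)) (h a r hr)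

  ⊩Args-cn-resp-≈ : ∀ {ℓ} ρ {f t t'} → t ≈ t' → ⊩Args ℓ ρ f (cn t) → ⊩Args ℓ ρ f (cn t')
  ⊩Args-cn-resp-≈ ρ e = ⊩Args-resp-≗ ρ (λ rs → cn-resp-≈ e (Pointwiseᴸ.refl ≈-refl))

  ⊩-resp-≈ : ∀ {ℓ} ρ {a t t'} → t ≈ t' → ⊩ ℓ ρ a t → ⊩ ℓ ρ a t'
  ⊩-resp-≈ ρ e h ℓ' le = ⊩Args-cn-resp-≈ ρ e (h ℓ' le)

  ⊩Args-antitone : ∀ {ℓ} ρ {f g K} → f ⊑ g → ⊩Args ℓ ρ g K → ⊩Args ℓ ρ f K
  ⊩Args-antitone ι       f⊆g h q q∈   = h q (f⊆g q∈)
  ⊩Args-antitone (ρ ⇒ σ) f⊑g h a r hr = ⊩Args-antitone σ (f⊑g a) (h a r hr)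

  ⊩-≤ : ∀ {ℓ ℓ' ρ a t} → ℓ' ≤ ℓ → ⊩ ℓ ρ a t → ⊩ ℓ' ρ a t
  ⊩-≤ le h ℓ'' le' = h ℓ'' (≤-trans le' le)

  ⊩Args-zero : ∀ ρ {f K} → ⊩Args 0 ρ f K
  ⊩Args-zero ι       q q∈     = tt
  ⊩Args-zero (ρ ⇒ σ) a r hr = ⊩Args-zero σ

  ∈-liftU : ∀ (d : Fin k → Fin k → Bool) S q → q ∈ liftU d ι S → Σ (Fin k) λ q' → d q q' ≡ true × q' ∈ S
  ∈-liftU d S q q∈ =
    let h∈ = ≡.trans (≡.sym (lookup∘tabulate _ q)) ([]=⇒lookup q∈)
        q' , dq'∧q'∈S = Any.satisfied (any⁻ _ (allFin k) (Equivalence.from T-≡ h∈))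
        dq' , q'∈S    = Equivalence.to T-∧ dq'∧q'∈S
    in q' , Equivalence.to T-≡ dq' , lookup⇒[]= q' S (Equivalence.to T-≡ q'∈S)

  data Unary : SLab m → Set where
    unaryR : Unary R
    unaryβ : Unary β

  -- liftR and liftβ are definitionally liftU (transition unaryR) and liftU (transition unaryβ).
  transition : ∀ {l} → Unary l → Fin k → Fin k → Bool
  transition unaryR q q' = δ q R (q' ∷ [])
  transition unaryβ q q' = δ q β (q' ∷ [])

  Run-unary : ∀ {l ℓ q q' T} (u : Unary l) → T [] ≡ l → transition u q q' ≡ true →
              Run ℓ q' (λ p → T (0 ∷ p)) → Run (suc ℓ) q T
  Run-unary {q' = q'} unaryR eT d r rewrite eT = q' ∷ [] , d , λ { zero → r }
  Run-unary {q' = q'} unaryβ eT d r rewrite eT = q' ∷ [] , d , λ { zero → r }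

  ⊩Args-lift : ∀ {l ℓ} (u : Unary l) ρ {g} K → (∀ rs → K rs [] ≡ l) →
               ⊩Args ℓ ρ g (λ rs p → K rs (0 ∷ p)) → ⊩Args (suc ℓ) ρ (liftU (transition u) ρ g) K
  ⊩Args-lift u ι {g} K eK h q q∈ =
    let q' , d , q'∈ = ∈-liftU (transition u) g q q∈
    in Run-unary {T = K []} u (eK []) d (h q' q'∈)
  ⊩Args-lift {ℓ = ℓ} u (ρ ⇒ σ) K eK h a r hr =
    ⊩Args-lift u σ (λ rs → K (proj₁ r ∷ rs)) (λ rs → eK _) (h a r (⊩-≤ (n≤1+n ℓ) hr))

  ⊩Args-ιⁿ : ∀ {ℓ} n {f K} →
             (∀ as (rs : Vec RawTree n) → Pointwiseⱽ (⊩ ℓ ι) as rs →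
               ∀ q → q ∈ appN n f as → Run ℓ q (K (toList rs))) →
             ⊩Args ℓ (ιⁿ n) f K
  ⊩Args-ιⁿ zero    h q q∈   = h [] [] [] q q∈
  ⊩Args-ιⁿ (suc n) h a r hr = ⊩Args-ιⁿ n λ as rs hs → h (a ∷ as) (proj₁ r ∷ rs) (hr ∷ hs)

  nth-toList : ∀ {n} (rs : Vec RawTree n) i → nth (toList rs) (toℕ i) ≡ just (lookup rs i)
  nth-toList (r ∷ rs) zero    = refl
  nth-toList (r ∷ rs) (suc i) = nth-toList rs i

  Run-con : ∀ {ℓ q c T} → T [] ≡ sym c → (qs : Vec (Fin k) (ar c)) → δ q (sym c) qs ≡ true →
            (∀ i → Run ℓ (lookup qs i) (λ p → T (toℕ i ∷ p))) → Run (suc ℓ) q T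
  Run-con eT qs d rs rewrite eT = qs , d , rs

  ⊩Args-con : ∀ ℓ c {f T} → T [] ≡ con c → ConOK c f → ⊩Args ℓ (ιⁿ (ar c)) f (cn T)
  ⊩Args-con zero    c _ _ = ⊩Args-zero (ιⁿ (ar c))
  ⊩Args-con (suc ℓ) c {T = T} eT ok = ⊩Args-ιⁿ (ar c) λ as rs hs q q∈ →
    let qs , d , qs∈ = ok as q q∈
        root , below = cn-con {T} eT (toList rs)
    in Run-con {T = cn T (toList rs)} root qs d λ i →
         Run-resp-≗ (λ p → ≡.sym (below (toℕ i) p (nth-toList rs i)))
                    (Pointwiseⱽ.lookup hs i ℓ (n≤1+n ℓ) (lookup qs i) (qs∈ i))

  ⊩Args-app : ∀ {ℓ ρ σ f u T} → T [] ≡ app σ → WT [] σ (child arg T) →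
              ⊩Args ℓ (σ ⇒ ρ) f (cn (child fun T)) → ⊩ ℓ σ u (child arg T) →
              ⊩Args (suc ℓ) ρ (liftR ρ (f u)) (cn T)
  ⊩Args-app {ρ = ρ} {u = u} {T} eT wa hf hu =
    ⊩Args-lift unaryR ρ (cn T) (λ rs → proj₁ (cn-app {T} eT rs))
      (⊩Args-resp-≗ ρ (λ rs p → ≡.sym (proj₂ (cn-app {T} eT rs) 0 p)) (hf u (child arg T , wa) hu))

  ⊩Args-lam : ∀ {ℓ σ τ g T} → T [] ≡ lam σ →
              (∀ a (r : Tm [] σ) → ⊩ ℓ σ a (proj₁ r) →
                ⊩Args ℓ τ (g a) (cn (sub 0 (proj₁ r ∷ []) (child body T)))) →
              ⊩Args (suc ℓ) (σ ⇒ τ) (liftβ (σ ⇒ τ) g) (cn T)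
  ⊩Args-lam {σ = σ} {τ} {T = T} eT h =
    ⊩Args-lift unaryβ (σ ⇒ τ) (cn T) (λ rs → proj₁ (cn-lam {T} eT rs))
      λ a r hr → ⊩Args-resp-≗ τ (λ rs p → ≡.sym (proj₂ (cn-lam {T} eT rs) (proj₁ r) 0 p)) (h a r hr)

  ⊩Env : ℕ → ∀ {Γ} → Env Γ → All (Tm []) Γ → Set
  ⊩Env ℓ {Γ} γ ts = ∀ {i τ} (x : Var Γ i τ) → ⊩ ℓ τ (lookupV γ x) (proj₁ (lookupV ts x))

  ⊩Env-≤ : ∀ {ℓ ℓ' Γ} (γ : Env Γ) ts → ℓ' ≤ ℓ → ⊩Env ℓ γ ts → ⊩Env ℓ' γ ts
  ⊩Env-≤ γ ts le hγ x = ⊩-≤ le (hγ x)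

  ⊩Env-∷ : ∀ {ℓ Γ σ} a r (γ : Env Γ) ts → ⊩ ℓ σ a (proj₁ r) → ⊩Env ℓ γ ts → ⊩Env ℓ (a ∷ γ) (r ∷ ts)
  ⊩Env-∷ a r γ ts ha hγ here      = ha
  ⊩Env-∷ a r γ ts ha hγ (there x) = hγ x

  raws-closed : ∀ {Γ} (ts : All (Tm []) Γ) → All Closed (raws ts)
  raws-closed []       = []
  raws-closed (t ∷ ts) = WT⇒Closed (proj₂ t) ∷ raws-closed ts

  sub-body-∷ : ∀ {Γ} (ts : All (Tm []) Γ) t {σ} r → t [] ≡ lam σ →
               sub 0 (r ∷ []) (child body (sub 0 (raws ts) t)) ≈ sub 0 (r ∷ raws ts) (child body t)
  sub-body-∷ ts t r et =
    ≈-trans (sub-resp-≈ (≗⇒≈ (sub-child 0 (raws ts) t body et)) (≈-refl ∷ []) 0)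
            (sub-fuse r (raws-closed ts) 0 (child body t))

  soundness : ∀ n {Γ ρ} (γ : Env Γ) a (t : Tm Γ ρ) → ⊢ n γ ρ a (proj₁ t) →
              ∀ ℓ → ℓ ≤ n → (ts : All (Tm []) Γ) → ⊩Env ℓ γ ts → ⊩Args ℓ ρ a (cn (t [ ts ]))
  soundness n {ρ = ρ} γ a t H zero _ ts hγ = ⊩Args-zero ρ
  soundness (suc n) {ρ = ρ} γ a (t , w) H (suc ℓ) (s≤s ℓ≤n) ts hγ with t [] in et
  soundness (suc n) {ρ = ρ} γ a (t , w) (x , a⊑) (suc ℓ) (s≤s ℓ≤n) ts hγ | var i =
    ⊩Args-antitone ρ a⊑ (⊩Args-cn-resp-≈ ρ (≈-sym (≗⇒≈ (sub-free 0 (raws ts) t et z≤n (nth-raws ts x))))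
                                         (hγ x (suc ℓ) ≤-refl))
  soundness (suc n) {ρ = ρ} γ a (t , w) (f , u , a⊑ , Hf , Hu) (suc ℓ) (s≤s ℓ≤n) ts hγ | app σ =
    ⊩Args-antitone ρ a⊑ (⊩Args-app eT (proj₂ (WT-children (WT-sub [] ts w) eT)) hf hu)
    where
    eT : sub 0 (raws ts) t [] ≡ app σ
    eT = sub-root 0 (raws ts) t et
    hf : ⊩Args ℓ (σ ⇒ ρ) f (cn (child fun (sub 0 (raws ts) t)))
    hf = ⊩Args-cn-resp-≈ (σ ⇒ ρ) (≈-sym (≗⇒≈ (sub-child 0 (raws ts) t fun et)))
           (soundness n γ f (child fun t , proj₁ (WT-children w et)) Hf ℓ ℓ≤n ts (⊩Env-≤ γ ts (n≤1+n ℓ) hγ))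
    hu : ⊩ ℓ σ u (child arg (sub 0 (raws ts) t))
    hu = ⊩-resp-≈ σ (≈-sym (≗⇒≈ (sub-child 0 (raws ts) t arg et))) λ ℓ' ℓ'≤ℓ →
           soundness n γ u (child arg t , proj₂ (WT-children w et)) Hu ℓ' (≤-trans ℓ'≤ℓ ℓ≤n) ts
                     (⊩Env-≤ γ ts (≤-trans ℓ'≤ℓ (n≤1+n ℓ)) hγ)
  soundness (suc n) {ρ = ρ} γ a (t , w) H (suc ℓ) (s≤s ℓ≤n) ts hγ | lam σ with WT-root w et
  ... | τ , refl =
    ⊩Args-antitone (σ ⇒ τ) {K = cn T} (λ b → proj₁ (proj₂ (H b)))
      (⊩Args-lam {T = T} (sub-root 0 (raws ts) t et) λ b r hr →
        ⊩Args-cn-resp-≈ τ (≈-sym (sub-body-∷ ts t (proj₁ r) et))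
          (soundness n (b ∷ γ) (proj₁ (H b)) (child body t , WT-children w et) (proj₂ (proj₂ (H b)))
                     ℓ ℓ≤n (r ∷ ts) (⊩Env-∷ b r γ ts hr (⊩Env-≤ γ ts (n≤1+n ℓ) hγ))))
    where
    T : RawTree
    T = sub 0 (raws ts) t
  soundness (suc n) γ a (t , w) (refl , ok) (suc ℓ) (s≤s ℓ≤n) ts hγ | con c =
    ⊩Args-con (suc ℓ) c (sub-root 0 (raws ts) t et) ok

theorem7p5 : (m : ℕ) (ar : Fin m → ℕ) (k : ℕ)
    (δ : Fin k → (l : SLab m) → Vec (Fin k) (arS ar l) → Bool) →
    let open Theory m ar k δ in
    ∀ {Γ : Ctx} {ρ : Ty} (n : ℕ) (γ : Env Γ) (a : ⟦ ρ ⟧) (t : Tm Γ ρ) →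
    ⊢ n γ ρ a (proj₁ t) →
    ∀ (ℓ : ℕ) → ℓ ≤ n → (ts : All (Tm []) Γ) →
    (∀ {i τ} (x : Var Γ i τ) → ⊩ ℓ τ (lookupV γ x) (proj₁ (lookupV ts x))) →
    ⊩ ℓ ρ a (t [ ts ])
theorem7p5 m ar k δ n γ a t H ℓ ℓ≤n ts hγ ℓ' ℓ'≤ℓ =
  soundness n γ a t H ℓ' (≤-trans ℓ'≤ℓ ℓ≤n) ts (⊩Env-≤ γ ts ℓ'≤ℓ hγ)
  where open Soundness m ar k δ
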